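{- For every integer $k\ge1$, the number of standard Young tableaux of size $2^k-1$ having exactly two rows is even.
   Context: A standard Young tableau of size $n$ is a filling of the Young diagram of a partition of $n$ with the numbers $1,\dots,n$, each used once, increasing along rows and down columns. -}

module Defs where

open import Data.Nat using (ℕ; suc; _+_; _≤_; _<_)
open import Data.Fin as Fin using (Fin)
open import Data.Vec using (Vec; lookup; toList)
open import Data.List using (List; map; upTo; _++_; length)
open import Data.List.Relation.Binary.Permutation.Propositional using (_↭_)
open import Data.List.Relation.Unary.Any using (Any)
open import Data.List.Relation.Unary.AllPairs using (AllPairs)
open import Data.Product using (_×_)
open import Relation.Binary.PropositionalEquality using (_≡_)
open import Relation.Nullary using (¬_)

-- A standard Young tableau of size n whose shape has exactly two rows:
-- shape λ = (a , b) with a ≥ b ≥ 1 and a + b = n; row 1 has entries r1,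
-- row 2 has entries r2 (cell (2,j) lies below cell (1,j)).
record TwoRowSYT (n : ℕ) : Set where
  field
    a b   : ℕ
    b≥1   : 1 ≤ b
    b≤a   : b ≤ a
    size  : a + b ≡ n
    r1    : Vec ℕ a
    r2    : Vec ℕ b
    fill  : (toList r1 ++ toList r2) ↭ map suc (upTo n)
    row1  : ∀ (i j : Fin a) → i Fin.< j → lookup r1 i < lookup r1 j
    row2  : ∀ (i j : Fin b) → i Fin.< j → lookup r2 i < lookup r2 j
    col   : ∀ (j : Fin b) → lookup r1 (Fin.inject≤ j b≤a) < lookup r2 j

open TwoRowSYT public

_≈T_ : ∀ {n} → TwoRowSYT n → TwoRowSYT n → Set
s ≈T t = (toList (r1 s) ≡ toList (r1 t)) × (toList (r2 s) ≡ toList (r2 t))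

-- L is an exhaustive, repetition-free enumeration of the two-row SYT of size n;
-- its length is then "the number" of such tableaux.
Enumerates : (n : ℕ) → List (TwoRowSYT n) → Set
Enumerates n L = (∀ t → Any (t ≈T_) L) × AllPairs (λ s t → ¬ (s ≈T t)) L

module Submission where

-- Record a two-row standard Young tableau of size n as the word whose i-th letter says whether
-- i lies in the first row.  Column strictness becomes the ballot condition, so the tableaux
-- correspond to the ballot words of length n other than the all-true word: their number is one
-- less than the number of ±1 lattice paths of length n from 0 that never go negative.  Modulo 2
-- that path count is the central binomial coefficient n C ⌊n/2⌋ (a parity shadow of the
-- reflection principle), and for n = 2^k − 1 Lucas's theorem makes this coefficient odd.

open import Defs
open import Data.Bool using (Bool; true; false; T)
open import Data.Empty using (⊥; ⊥-elim)
open import Data.Fin as Fin using (Fin; zero; suc)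
open import Data.List using (List; []; _∷_; _++_; [_]; length; map; upTo; applyUpTo)
open import Data.List.Properties
  using (++-assoc; length-++; length-map; map-upTo; ∷-injectiveʳ; ++-conicalˡ; ++-conicalʳ)
open import Data.List.Membership.Propositional using (_∈_; mapWith∈)
open import Data.List.Membership.Propositional.Properties using (∈-++⁻; ∈-++⁺ˡ; ∈-++⁺ʳ; ∈-map⁺; ∈-map⁻)
import Data.List.Membership.Setoid.Properties as SetoidMembership
open import Data.List.Relation.Binary.Disjoint.Propositional using (Disjoint)
open import Data.List.Relation.Binary.Permutation.Propositional
  using (_↭_; prep; ↭-sym; ↭-trans; ↭-reflexive)
open import Data.List.Relation.Binary.Permutation.Propositional.Properties
  using (↭-empty-inv; ∈-resp-↭; All-resp-↭; shift; drop-∷)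
open import Data.List.Relation.Binary.Sublist.Propositional using (_⊆_; []; _∷_; _∷ʳ_)
open import Data.List.Relation.Binary.Sublist.Propositional.Properties using (All-resp-⊆)
open import Data.List.Relation.Unary.All as All using (All; []; _∷_)
open import Data.List.Relation.Unary.All.Properties using (∷ʳ⁺; ++⁻ʳ)
import Data.List.Relation.Unary.All.Properties as All
open import Data.List.Relation.Unary.Any using (Any; here; there)
open import Data.List.Relation.Unary.Any.Properties using (mapWith∈⁺)
open import Data.List.Relation.Unary.AllPairs using (AllPairs; []; _∷_)
open import Data.List.Relation.Unary.Unique.Propositional using (Unique)
import Data.List.Relation.Unary.Unique.Propositional.Properties as Unique
open import Data.Nat using (ℕ; zero; suc; _+_; _*_; _^_; _∸_; _≤_; _<_; z≤n; s≤s; s≤s⁻¹; z<s; s<s; parity)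
open import Data.Nat.Properties
  using (*-suc; +-suc; +-comm; +-identityʳ; m+n∸n≡m; m≤m+n; m≤n⇒m≤1+n; m<n⇒m<1+n;
         ≤-refl; ≤-reflexive; <-irrefl; <-asym; <⇒≤; <⇒≱)
open import Data.Nat.Combinatorics using (_C_; nCk+nC[k+1]≡[n+1]C[k+1]; nCk≡nC[n∸k]; nC1≡n)
open import Data.Nat.Divisibility using (_∣_; divides)
open import Data.Parity.Base as ℙ using (Parity; 0ℙ; 1ℙ; _⁻¹)
open import Data.Parity.Properties as ℙ using (+-homo-+; *-homo-*; p+p≡0ℙ; suc-homo-⁻¹)
open import Data.Product using (Σ; Σ-syntax; _×_; _,_)
open import Data.Sum using (inj₁; inj₂)
open import Data.Unit using (⊤; tt)
open import Data.Vec using (Vec; []; _∷_; lookup; fromList; toList)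
open import Data.Vec.Properties using (toList∘fromList)
import Data.Vec.Relation.Unary.All.Properties as VecAll
open import Function using (_∘_)
open import Relation.Binary.PropositionalEquality
  using (_≡_; refl; sym; trans; cong; cong₂; subst; subst₂; setoid; module ≡-Reasoning)
open import Relation.Nullary using (¬_; contradiction)

open ≡-Reasoning

-- Binomial coefficients and lattice paths modulo 2

parity-pascal : ∀ n k → parity (suc n C suc k) ≡ parity (n C k) ℙ.+ parity (n C suc k)
parity-pascal n k = trans (cong parity (sym (nCk+nC[k+1]≡[n+1]C[k+1] n k))) (+-homo-+ (n C k) (n C suc k))

parity-double : ∀ n → parity (2 * n) ≡ 0ℙ
parity-double n = *-homo-* 2 n

-- Lucas's theorem modulo 2, one binary digit at a time.
mutual
  parity-C-double : ∀ n j → parity (2 * n C 2 * j) ≡ parity (n C j)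
  parity-C-double n       zero    = refl
  parity-C-double zero    (suc j) = refl
  parity-C-double (suc n) (suc j) = begin
    parity (2 * suc n C 2 * suc j)
      ≡⟨ cong₂ (λ a b → parity (a C b)) (*-suc 2 n) (*-suc 2 j) ⟩
    parity (suc (suc (2 * n)) C suc (suc (2 * j)))
      ≡⟨ parity-pascal (suc (2 * n)) (suc (2 * j)) ⟩
    parity (suc (2 * n) C suc (2 * j)) ℙ.+ parity (suc (2 * n) C suc (suc (2 * j)))
      ≡⟨ cong₂ ℙ._+_ (parity-C-suc-double n j) (parity-pascal (2 * n) (suc (2 * j))) ⟩
    parity (n C j) ℙ.+ (parity (2 * n C suc (2 * j)) ℙ.+ parity (2 * n C suc (suc (2 * j))))
      ≡⟨ cong (λ p → parity (n C j) ℙ.+ (p ℙ.+ parity (2 * n C suc (suc (2 * j))))) (parity-C-double-suc n j) ⟩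
    parity (n C j) ℙ.+ parity (2 * n C suc (suc (2 * j)))
      ≡⟨ cong (λ k → parity (n C j) ℙ.+ parity (2 * n C k)) (sym (*-suc 2 j)) ⟩
    parity (n C j) ℙ.+ parity (2 * n C 2 * suc j)
      ≡⟨ cong (parity (n C j) ℙ.+_) (parity-C-double n (suc j)) ⟩
    parity (n C j) ℙ.+ parity (n C suc j)
      ≡⟨ parity-pascal n j ⟨
    parity (suc n C suc j) ∎

  parity-C-double-suc : ∀ n j → parity (2 * n C suc (2 * j)) ≡ 0ℙ
  parity-C-double-suc zero    j       = refl
  parity-C-double-suc (suc n) zero    = trans (cong parity (nC1≡n (2 * suc n))) (parity-double (suc n))
  parity-C-double-suc (suc n) (suc j) = begin
    parity (2 * suc n C suc (2 * suc j))
      ≡⟨ cong₂ (λ a b → parity (a C suc b)) (*-suc 2 n) (*-suc 2 j) ⟩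
    parity (suc (suc (2 * n)) C suc (suc (suc (2 * j))))
      ≡⟨ parity-pascal (suc (2 * n)) (suc (suc (2 * j))) ⟩
    parity (suc (2 * n) C suc (suc (2 * j))) ℙ.+ parity (suc (2 * n) C suc (suc (suc (2 * j))))
      ≡⟨ cong₂ ℙ._+_ (parity-pascal (2 * n) (suc (2 * j))) (parity-pascal (2 * n) (suc (suc (2 * j)))) ⟩
    (parity (2 * n C suc (2 * j)) ℙ.+ x) ℙ.+ (x ℙ.+ parity (2 * n C suc (suc (suc (2 * j)))))
      ≡⟨ cong₂ (λ p q → (p ℙ.+ x) ℙ.+ (x ℙ.+ q)) (parity-C-double-suc n j) odd-suc ⟩
    x ℙ.+ (x ℙ.+ 0ℙ)
      ≡⟨ cong (x ℙ.+_) (ℙ.+-identityʳ x) ⟩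
    x ℙ.+ x
      ≡⟨ p+p≡0ℙ x ⟩
    0ℙ ∎
    where
    x : Parity
    x = parity (2 * n C suc (suc (2 * j)))
    odd-suc : parity (2 * n C suc (suc (suc (2 * j)))) ≡ 0ℙ
    odd-suc = trans (cong (λ k → parity (2 * n C suc k)) (sym (*-suc 2 j))) (parity-C-double-suc n (suc j))

  parity-C-suc-double : ∀ n j → parity (suc (2 * n) C suc (2 * j)) ≡ parity (n C j)
  parity-C-suc-double n j = begin
    parity (suc (2 * n) C suc (2 * j))
      ≡⟨ parity-pascal (2 * n) (2 * j) ⟩
    parity (2 * n C 2 * j) ℙ.+ parity (2 * n C suc (2 * j))
      ≡⟨ cong₂ ℙ._+_ (parity-C-double n j) (parity-C-double-suc n j) ⟩
    parity (n C j) ℙ.+ 0ℙ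
      ≡⟨ ℙ.+-identityʳ (parity (n C j)) ⟩
    parity (n C j) ∎

parity-central-C : ∀ j → parity (2 * suc j C suc j) ≡ 0ℙ
parity-central-C j = begin
  parity (2 * suc j C suc j)
    ≡⟨ cong (λ a → parity (a C suc j)) (*-suc 2 j) ⟩
  parity (suc (suc (2 * j)) C suc j)
    ≡⟨ parity-pascal (suc (2 * j)) j ⟩
  parity (suc (2 * j) C j) ℙ.+ parity (suc (2 * j) C suc j)
    ≡⟨ cong (λ a → parity a ℙ.+ parity (suc (2 * j) C suc j)) symmetric ⟩
  parity (suc (2 * j) C suc j) ℙ.+ parity (suc (2 * j) C suc j)
    ≡⟨ p+p≡0ℙ (parity (suc (2 * j) C suc j)) ⟩
  0ℙ ∎
  where
  complement : suc (2 * j) ∸ j ≡ suc j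
  complement = trans (cong (λ a → suc (j + a) ∸ j) (+-identityʳ j)) (m+n∸n≡m (suc j) j)
  symmetric : suc (2 * j) C j ≡ suc (2 * j) C suc j
  symmetric = trans (nCk≡nC[n∸k] (m≤n⇒m≤1+n (m≤m+n j (j + 0)))) (cong (suc (2 * j) C_) complement)

ballotCount : ℕ → ℕ → ℕ
ballotCount zero    h       = 1
ballotCount (suc n) zero    = ballotCount n 1
ballotCount (suc n) (suc h) = ballotCount n (suc (suc h)) + ballotCount n h

ballotCount-≤ : ∀ {n h} → n ≤ h → ballotCount n h ≡ 2 ^ n
ballotCount-≤ {zero}          _         = refl
ballotCount-≤ {suc n} {suc h} (s≤s n≤h) = begin
  ballotCount n (suc (suc h)) + ballotCount n h
    ≡⟨ cong₂ _+_ (ballotCount-≤ (m≤n⇒m≤1+n (m≤n⇒m≤1+n n≤h))) (ballotCount-≤ n≤h) ⟩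
  2 ^ n + 2 ^ n
    ≡⟨ cong (2 ^ n +_) (+-identityʳ (2 ^ n)) ⟨
  2 ^ suc n ∎

parity-ballotCount-< : ∀ {n h} → n < h → parity (ballotCount (suc n) h) ≡ 0ℙ
parity-ballotCount-< {n} n<h = trans (cong parity (ballotCount-≤ n<h)) (parity-double (2 ^ n))

-- ballotCount m h is 2 ^ m minus the number of paths from h that reach −1; reflecting those
-- paths at −1 shows that this correction is ≡ m C j (mod 2) when m = h + 2j + 1.
parity-ballotCount : ∀ {m} h j → m ≡ h + 2 * j → parity (ballotCount (suc m) h) ≡ parity (suc m C j)
parity-ballotCount zero zero refl = refl
parity-ballotCount zero (suc j) refl = begin
  parity (ballotCount (2 * suc j) 1)            ≡⟨ parity-ballotCount 1 j (+-suc j (j + 0)) ⟩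
  parity (2 * suc j C j)                       ≡⟨ ℙ.+-identityʳ _ ⟨
  parity (2 * suc j C j) ℙ.+ 0ℙ                ≡⟨ cong (parity (2 * suc j C j) ℙ.+_) (parity-central-C j) ⟨
  parity (2 * suc j C j) ℙ.+ parity (2 * suc j C suc j) ≡⟨ parity-pascal (2 * suc j) j ⟨
  parity (suc (2 * suc j) C suc j) ∎
parity-ballotCount (suc h) zero refl = begin
  parity (ballotCount (suc (h + 0)) (suc (suc h)) + ballotCount (suc (h + 0)) h)
    ≡⟨ +-homo-+ (ballotCount (suc (h + 0)) (suc (suc h))) _ ⟩
  parity (ballotCount (suc (h + 0)) (suc (suc h))) ℙ.+ parity (ballotCount (suc (h + 0)) h)
    ≡⟨ cong₂ ℙ._+_ (parity-ballotCount-< h+0<2+h) (parity-ballotCount h 0 refl) ⟩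
  parity (suc (h + 0) C 0) ∎
  where
  h+0<2+h : h + 0 < suc (suc h)
  h+0<2+h = s≤s (m≤n⇒m≤1+n (≤-reflexive (+-identityʳ h)))
parity-ballotCount (suc h) (suc j) refl = begin
  parity (ballotCount (suc m′) (suc (suc h)) + ballotCount (suc m′) h)
    ≡⟨ +-homo-+ (ballotCount (suc m′) (suc (suc h))) _ ⟩
  parity (ballotCount (suc m′) (suc (suc h))) ℙ.+ parity (ballotCount (suc m′) h)
    ≡⟨ cong₂ ℙ._+_ (parity-ballotCount (suc (suc h)) j m′-shift) (parity-ballotCount h (suc j) refl) ⟩
  parity (suc m′ C j) ℙ.+ parity (suc m′ C suc j)
    ≡⟨ parity-pascal (suc m′) j ⟨
  parity (suc (suc m′) C suc j) ∎
  where
  m′ : ℕ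
  m′ = h + 2 * suc j
  m′-shift : m′ ≡ suc (suc h) + 2 * j
  m′-shift = trans (cong (h +_) (*-suc 2 j)) (trans (+-suc h (suc (2 * j))) (cong suc (+-suc h (2 * j))))

mersenne : ℕ → ℕ
mersenne zero    = 0
mersenne (suc k) = suc (2 * mersenne k)

2^k≡1+mersenne : ∀ k → 2 ^ k ≡ suc (mersenne k)
2^k≡1+mersenne zero    = refl
2^k≡1+mersenne (suc k) = trans (cong (2 *_) (2^k≡1+mersenne k)) (*-suc 2 (mersenne k))

2^k∸1≡mersenne : ∀ k → 2 ^ k ∸ 1 ≡ mersenne k
2^k∸1≡mersenne k = cong (_∸ 1) (2^k≡1+mersenne k)

parity-mersenne-C : ∀ k → parity (mersenne (suc k) C mersenne k) ≡ 1ℙ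
parity-mersenne-C zero    = refl
parity-mersenne-C (suc k) = trans (parity-C-suc-double (mersenne (suc k)) (mersenne k)) (parity-mersenne-C k)

parity-ballotCount-mersenne : ∀ k → parity (ballotCount (mersenne (suc k)) 0) ≡ 1ℙ
parity-ballotCount-mersenne k = trans (parity-ballotCount 0 (mersenne k) refl) (parity-mersenne-C k)

-- Two-row tableaux as ballot words

Word : Set
Word = List Bool

-- The letters of w place the entries p, p + 1, … in turn; true means the first row.
firstRow secondRow : ℕ → Word → List ℕ
firstRow p []          = []
firstRow p (true  ∷ w) = p ∷ firstRow (suc p) w
firstRow p (false ∷ w) = firstRow (suc p) w
secondRow p []          = []
secondRow p (true  ∷ w) = secondRow (suc p) w
secondRow p (false ∷ w) = p ∷ secondRow (suc p) w

range : ℕ → ℕ → List ℕ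
range p zero    = []
range p (suc m) = p ∷ range (suc p) m

Ballot : ℕ → Word → Set
Ballot h       []          = ⊤
Ballot h       (true  ∷ w) = Ballot (suc h) w
Ballot zero    (false ∷ w) = ⊥
Ballot (suc h) (false ∷ w) = Ballot h w

data ColumnStrict : List ℕ → List ℕ → Set where
  []  : ∀ {xs} → ColumnStrict xs []
  _∷_ : ∀ {x y xs ys} → x < y → ColumnStrict xs ys → ColumnStrict (x ∷ xs) (y ∷ ys)

columnStrict-length : ∀ {xs ys} → ColumnStrict xs ys → length ys ≤ length xs
columnStrict-length []       = z≤n
columnStrict-length (_ ∷ cs) = s≤s (columnStrict-length cs)

applyUpTo-range : ∀ {f} m → (∀ i → f (suc i) ≡ suc (f i)) → applyUpTo f m ≡ range (f 0) m
applyUpTo-range zero    _    = refl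
applyUpTo-range {f} (suc m) step =
  cong (f 0 ∷_) (trans (applyUpTo-range m (step ∘ suc)) (cong (λ p → range p m) (step 0)))

map-suc-upTo : ∀ n → map suc (upTo n) ≡ range 1 n
map-suc-upTo n = trans (map-upTo suc n) (applyUpTo-range n (λ _ → refl))

range-lower : ∀ p m → All (p ≤_) (range p m)
range-lower p zero    = []
range-lower p (suc m) = ≤-refl ∷ All.map <⇒≤ (range-lower (suc p) m)

range-sorted : ∀ p m → AllPairs _<_ (range p m)
range-sorted p zero    = []
range-sorted p (suc m) = range-lower (suc p) m ∷ range-sorted (suc p) m

AllPairs-resp-⊆ : ∀ {R : ℕ → ℕ → Set} {xs ys} → xs ⊆ ys → AllPairs R ys → AllPairs R xs
AllPairs-resp-⊆ []          []          = []
AllPairs-resp-⊆ (_ ∷ʳ sub)  (_ ∷ rys)   = AllPairs-resp-⊆ sub rys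
AllPairs-resp-⊆ (refl ∷ sub) (ry ∷ rys) = All-resp-⊆ sub ry ∷ AllPairs-resp-⊆ sub rys

firstRow-⊆ : ∀ p w → firstRow p w ⊆ range p (length w)
firstRow-⊆ p []          = []
firstRow-⊆ p (true  ∷ w) = refl ∷ firstRow-⊆ (suc p) w
firstRow-⊆ p (false ∷ w) = p ∷ʳ firstRow-⊆ (suc p) w

secondRow-⊆ : ∀ p w → secondRow p w ⊆ range p (length w)
secondRow-⊆ p []          = []
secondRow-⊆ p (true  ∷ w) = p ∷ʳ secondRow-⊆ (suc p) w
secondRow-⊆ p (false ∷ w) = refl ∷ secondRow-⊆ (suc p) w

firstRow-sorted : ∀ p w → AllPairs _<_ (firstRow p w)
firstRow-sorted p w = AllPairs-resp-⊆ (firstRow-⊆ p w) (range-sorted p (length w))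

secondRow-sorted : ∀ p w → AllPairs _<_ (secondRow p w)
secondRow-sorted p w = AllPairs-resp-⊆ (secondRow-⊆ p w) (range-sorted p (length w))

firstRow-lower : ∀ p w → All (p ≤_) (firstRow p w)
firstRow-lower p w = All-resp-⊆ (firstRow-⊆ p w) (range-lower p (length w))

rows-↭-range : ∀ p w → firstRow p w ++ secondRow p w ↭ range p (length w)
rows-↭-range p []          = ↭-reflexive refl
rows-↭-range p (true  ∷ w) = prep p (rows-↭-range (suc p) w)
rows-↭-range p (false ∷ w) =
  ↭-trans (shift p (firstRow (suc p) w) (secondRow (suc p) w)) (prep p (rows-↭-range (suc p) w))

rows-length : ∀ p w → length (firstRow p w) + length (secondRow p w) ≡ length w
rows-length p []          = refl
rows-length p (true  ∷ w) = cong suc (rows-length (suc p) w)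
rows-length p (false ∷ w) = trans (+-suc _ _) (cong suc (rows-length (suc p) w))

∈-secondRow⇒false∈ : ∀ {x} p w → x ∈ secondRow p w → false ∈ w
∈-secondRow⇒false∈ p (true  ∷ w) x∈ = there (∈-secondRow⇒false∈ (suc p) w x∈)
∈-secondRow⇒false∈ p (false ∷ w) _  = here refl

false∈⇒secondRow-nonempty : ∀ p w → false ∈ w → 1 ≤ length (secondRow p w)
false∈⇒secondRow-nonempty p (true  ∷ w) (there f) = false∈⇒secondRow-nonempty (suc p) w f
false∈⇒secondRow-nonempty p (false ∷ w) _         = s≤s z≤n

p∉firstRow[1+p] : ∀ p w → ¬ p ∈ firstRow (suc p) w
p∉firstRow[1+p] p w p∈ = <-irrefl refl (All.lookup (firstRow-lower (suc p) w) p∈)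

rows-injective : ∀ p u v → firstRow p u ≡ firstRow p v → secondRow p u ≡ secondRow p v → u ≡ v
rows-injective p []          []          _  _  = refl
rows-injective p (true  ∷ u) (true  ∷ v) e₁ e₂ =
  cong (true ∷_) (rows-injective (suc p) u v (∷-injectiveʳ e₁) e₂)
rows-injective p (false ∷ u) (false ∷ v) e₁ e₂ =
  cong (false ∷_) (rows-injective (suc p) u v e₁ (∷-injectiveʳ e₂))
rows-injective p (true  ∷ u) (false ∷ v) e₁ _  = ⊥-elim (p∉firstRow[1+p] p v (subst (p ∈_) e₁ (here refl)))
rows-injective p (false ∷ u) (true  ∷ v) e₁ _  = ⊥-elim (p∉firstRow[1+p] p u (subst (p ∈_) (sym e₁) (here refl)))
rows-injective p []          (true  ∷ v) ()  _
rows-injective p []          (false ∷ v) _   ()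
rows-injective p (true  ∷ u) []          ()  _
rows-injective p (false ∷ u) []          _   ()

length-∷ʳ : ∀ (q : List ℕ) x → length (q ++ [ x ]) ≡ suc (length q)
length-∷ʳ q x = trans (length-++ q) (+-comm (length q) 1)

-- q holds the first-row entries that are still waiting for a second-row entry below them.
ballot⇒columnStrict : ∀ w p q → All (_< p) q → Ballot (length q) w →
                      ColumnStrict (q ++ firstRow p w) (secondRow p w)
ballot⇒columnStrict []          p q       _           _ = []
ballot⇒columnStrict (true  ∷ w) p q       q<p         b =
  subst (λ xs → ColumnStrict xs (secondRow (suc p) w)) (++-assoc q [ p ] (firstRow (suc p) w))
    (ballot⇒columnStrict w (suc p) (q ++ [ p ]) (∷ʳ⁺ (All.map m<n⇒m<1+n q<p) ≤-refl)
      (subst (λ h → Ballot h w) (sym (length-∷ʳ q p)) b))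
ballot⇒columnStrict (false ∷ w) p (x ∷ q) (x<p ∷ q<p) b =
  x<p ∷ ballot⇒columnStrict w (suc p) q (All.map m<n⇒m<1+n q<p) b

columnStrict⇒ballot : ∀ w p q → All (_< p) q → ColumnStrict (q ++ firstRow p w) (secondRow p w) →
                      Ballot (length q) w
columnStrict⇒ballot []          p q       _           _ = tt
columnStrict⇒ballot (true  ∷ w) p q       q<p         cs =
  subst (λ h → Ballot h w) (length-∷ʳ q p)
    (columnStrict⇒ballot w (suc p) (q ++ [ p ]) (∷ʳ⁺ (All.map m<n⇒m<1+n q<p) ≤-refl)
      (subst (λ xs → ColumnStrict xs (secondRow (suc p) w)) (sym (++-assoc q [ p ] (firstRow (suc p) w))) cs))
columnStrict⇒ballot (false ∷ w) p []      _           cs = unmatched (firstRow-lower (suc p) w) cs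
  where
  unmatched : ∀ {xs ys} → All (suc p ≤_) xs → ColumnStrict xs (p ∷ ys) → ⊥
  unmatched (p<x ∷ _) (x<p ∷ _) = <-asym p<x x<p
columnStrict⇒ballot (false ∷ w) p (x ∷ q) (_ ∷ q<p)   (_ ∷ cs) =
  columnStrict⇒ballot w (suc p) q (All.map m<n⇒m<1+n q<p) cs

sorted-min : ∀ {p x xs} → AllPairs _<_ (x ∷ xs) → p ∈ x ∷ xs → p ≤ x → x ≡ p
sorted-min _          (here p≡x) _   = sym p≡x
sorted-min (x<xs ∷ _) (there p∈) p≤x = contradiction p≤x (<⇒≱ (All.lookup x<xs p∈))

rows-surjective : ∀ p m {xs ys} → AllPairs _<_ xs → AllPairs _<_ ys → xs ++ ys ↭ range p m →
               Σ[ w ∈ Word ] length w ≡ m × firstRow p w ≡ xs × secondRow p w ≡ ys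
rows-surjective p zero {xs} {ys} _ _ xs++ys↭ =
  [] , refl , sym (++-conicalˡ xs ys empty) , sym (++-conicalʳ xs ys empty)
  where empty : xs ++ ys ≡ []
        empty = ↭-empty-inv xs++ys↭
rows-surjective p (suc m) {xs} {ys} xs↑ ys↑ xs++ys↭ with ∈-++⁻ xs (∈-resp-↭ (↭-sym xs++ys↭) (here refl))
rows-surjective p (suc m) {x ∷ xs} {ys} (x<xs ∷ xs↑) ys↑ xs++ys↭ | inj₁ p∈
  with refl ← sorted-min (x<xs ∷ xs↑) p∈ (All.head (All-resp-↭ (↭-sym xs++ys↭) (range-lower p (suc m))))
  with w , |w| , w₁ , w₂ ← rows-surjective (suc p) m xs↑ ys↑ (drop-∷ xs++ys↭)
  = true ∷ w , cong suc |w| , cong (p ∷_) w₁ , w₂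
rows-surjective p (suc m) {xs} {y ∷ ys} xs↑ (y<ys ∷ ys↑) xs++ys↭ | inj₂ p∈
  with refl ← sorted-min (y<ys ∷ ys↑) p∈ (All.head (++⁻ʳ xs (All-resp-↭ (↭-sym xs++ys↭) (range-lower p (suc m)))))
  with w , |w| , w₁ , w₂ ← rows-surjective (suc p) m xs↑ ys↑ (drop-∷ (↭-trans (↭-sym (shift p xs ys)) xs++ys↭))
  = false ∷ w , cong suc |w| , w₁ , cong (p ∷_) w₂

IsBallot : Bool → ℕ → ℕ → Word → Set
IsBallot d n h w = length w ≡ n × Ballot h w × (T d → false ∈ w)

-- The flag asks for a false, i.e. a nonempty second row; after false ∷_ it is no longer needed.
ballots : Bool → ℕ → ℕ → List Word
ballots d     (suc n) zero    = map (true ∷_) (ballots d n 1)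
ballots d     (suc n) (suc h) = map (true ∷_) (ballots d n (suc (suc h))) ++ map (false ∷_) (ballots false n h)
ballots false zero    h       = [ [] ]
ballots true  zero    h       = []

IsBallot-true∷ : ∀ {d n h w} → IsBallot d n (suc h) w → IsBallot d (suc n) h (true ∷ w)
IsBallot-true∷ (|w| , ballot , hasDown) = cong suc |w| , ballot , there ∘ hasDown

IsBallot-false∷ : ∀ {d n h w} → IsBallot false n h w → IsBallot d (suc n) (suc h) (false ∷ w)
IsBallot-false∷ (|w| , ballot , _) = cong suc |w| , ballot , λ _ → here refl

ballots-sound : ∀ d n h → All (IsBallot d n h) (ballots d n h)
ballots-sound false zero    h       = (refl , tt , λ ()) ∷ []
ballots-sound true  zero    h       = []
ballots-sound d     (suc n) zero    = All.map⁺ (All.map IsBallot-true∷ (ballots-sound d n 1))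
ballots-sound d     (suc n) (suc h) =
  All.++⁺ (All.map⁺ (All.map IsBallot-true∷ (ballots-sound d n (suc (suc h)))))
          (All.map⁺ (All.map IsBallot-false∷ (ballots-sound false n h)))

false∈-tail : ∀ {w} → false ∈ true ∷ w → false ∈ w
false∈-tail (there f) = f

ballots-complete : ∀ d w h → Ballot h w → (T d → false ∈ w) → w ∈ ballots d (length w) h
ballots-complete false []          h       _      _       = here refl
ballots-complete true  []          h       _      hasDown with hasDown tt
... | ()
ballots-complete d     (true  ∷ w) zero    ballot hasDown =
  ∈-map⁺ (true ∷_) (ballots-complete d w 1 ballot (false∈-tail ∘ hasDown))
ballots-complete d     (true  ∷ w) (suc h) ballot hasDown =
  ∈-++⁺ˡ (∈-map⁺ (true ∷_) (ballots-complete d w (suc (suc h)) ballot (false∈-tail ∘ hasDown)))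
ballots-complete d     (false ∷ w) (suc h) ballot _       =
  ∈-++⁺ʳ (map (true ∷_) (ballots d (length w) (suc (suc h))))
         (∈-map⁺ (false ∷_) (ballots-complete false w h ballot λ ()))

true∷-false∷-disjoint : ∀ (us vs : List Word) → Disjoint (map (true ∷_) us) (map (false ∷_) vs)
true∷-false∷-disjoint us vs (∈us , ∈vs) with ∈-map⁻ (true ∷_) ∈us | ∈-map⁻ (false ∷_) ∈vs
... | _ , _ , refl | _ , _ , ()

ballots-unique : ∀ d n h → Unique (ballots d n h)
ballots-unique false zero    h       = [] ∷ []
ballots-unique true  zero    h       = []
ballots-unique d     (suc n) zero    = Unique.map⁺ ∷-injectiveʳ (ballots-unique d n 1)
ballots-unique d     (suc n) (suc h) =
  Unique.++⁺ (Unique.map⁺ ∷-injectiveʳ (ballots-unique d n (suc (suc h))))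
             (Unique.map⁺ ∷-injectiveʳ (ballots-unique false n h))
             (true∷-false∷-disjoint _ _)

length-ballots-suc : ∀ d n h →
  length (ballots d (suc n) (suc h)) ≡ length (ballots d n (suc (suc h))) + length (ballots false n h)
length-ballots-suc d n h = trans (length-++ (map (true ∷_) (ballots d n (suc (suc h)))))
  (cong₂ _+_ (length-map (true ∷_) (ballots d n (suc (suc h)))) (length-map (false ∷_) (ballots false n h)))

length-ballots-false : ∀ n h → length (ballots false n h) ≡ ballotCount n h
length-ballots-false zero    h       = refl
length-ballots-false (suc n) zero    = trans (length-map (true ∷_) (ballots false n 1)) (length-ballots-false n 1)
length-ballots-false (suc n) (suc h) =
  trans (length-ballots-suc false n h) (cong₂ _+_ (length-ballots-false n (suc (suc h))) (length-ballots-false n h))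

length-ballots-true : ∀ n h → suc (length (ballots true n h)) ≡ length (ballots false n h)
length-ballots-true zero    h       = refl
length-ballots-true (suc n) zero    = begin
  suc (length (map (true ∷_) (ballots true n 1)))  ≡⟨ cong suc (length-map (true ∷_) (ballots true n 1)) ⟩
  suc (length (ballots true n 1))                  ≡⟨ length-ballots-true n 1 ⟩
  length (ballots false n 1)                       ≡⟨ length-map (true ∷_) (ballots false n 1) ⟨
  length (map (true ∷_) (ballots false n 1))       ∎
length-ballots-true (suc n) (suc h) = begin
  suc (length (ballots true (suc n) (suc h)))
    ≡⟨ cong suc (length-ballots-suc true n h) ⟩
  suc (length (ballots true n (suc (suc h)))) + length (ballots false n h)
    ≡⟨ cong (_+ length (ballots false n h)) (length-ballots-true n (suc (suc h))) ⟩
  length (ballots false n (suc (suc h))) + length (ballots false n h)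
    ≡⟨ length-ballots-suc false n h ⟨
  length (ballots false (suc n) (suc h)) ∎

Increasing : ∀ {n} → Vec ℕ n → Set
Increasing {n} v = ∀ (i j : Fin n) → i Fin.< j → lookup v i < lookup v j

fromList-increasing : ∀ {xs} → AllPairs _<_ xs → Increasing (fromList xs)
fromList-increasing (x<xs ∷ _)   zero    (suc j) _         = VecAll.lookup⁺ (VecAll.fromList⁺ x<xs) j
fromList-increasing (_    ∷ xs↑) (suc i) (suc j) (s≤s i<j) = fromList-increasing xs↑ i j i<j

toList-sorted : ∀ {n} (v : Vec ℕ n) → Increasing v → AllPairs _<_ (toList v)
toList-sorted []      _   = []
toList-sorted (x ∷ v) inc =
  VecAll.toList⁺ (VecAll.lookup⁻ {xs = v} (λ j → inc zero (suc j) z<s))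
  ∷ toList-sorted v (λ i j i<j → inc (suc i) (suc j) (s<s i<j))

fromList-columnStrict : ∀ {xs ys} → ColumnStrict xs ys → .(le : length ys ≤ length xs) →
                        ∀ j → lookup (fromList xs) (Fin.inject≤ j le) < lookup (fromList ys) j
fromList-columnStrict (x<y ∷ _)  _  zero    = x<y
fromList-columnStrict (_   ∷ cs) le (suc j) = fromList-columnStrict cs (s≤s⁻¹ le) j

toList-columnStrict : ∀ {a b} (u : Vec ℕ a) (v : Vec ℕ b) .(le : b ≤ a) →
                      (∀ j → lookup u (Fin.inject≤ j le) < lookup v j) → ColumnStrict (toList u) (toList v)
toList-columnStrict u       []      _  _     = []
toList-columnStrict []      (_ ∷ _) ()
toList-columnStrict (x ∷ u) (y ∷ v) le below =
  below zero ∷ toList-columnStrict u v (s≤s⁻¹ le) (below ∘ suc)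

wordTableau : ∀ {N} (w : Word) → IsBallot true N 0 w → TwoRowSYT N
wordTableau {N} w (|w| , ballot , hasDown) = record
  { a    = length (firstRow 1 w)
  ; b    = length (secondRow 1 w)
  ; b≥1  = false∈⇒secondRow-nonempty 1 w (hasDown tt)
  ; b≤a  = columnStrict-length columns
  ; size = trans (rows-length 1 w) |w|
  ; r1   = fromList (firstRow 1 w)
  ; r2   = fromList (secondRow 1 w)
  ; fill = ↭-trans (↭-reflexive (cong₂ _++_ (toList∘fromList (firstRow 1 w)) (toList∘fromList (secondRow 1 w))))
             (↭-trans (rows-↭-range 1 w) (↭-reflexive (trans (cong (range 1) |w|) (sym (map-suc-upTo N)))))
  ; row1 = fromList-increasing (firstRow-sorted 1 w)
  ; row2 = fromList-increasing (secondRow-sorted 1 w)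
  ; col  = fromList-columnStrict columns (columnStrict-length columns)
  }
  where
  columns : ColumnStrict (firstRow 1 w) (secondRow 1 w)
  columns = ballot⇒columnStrict w 1 [] [] ballot

wordTableau-injective : ∀ {N} u v (gu : IsBallot true N 0 u) (gv : IsBallot true N 0 v) →
                        wordTableau u gu ≈T wordTableau v gv → u ≡ v
wordTableau-injective u v _ _ (e₁ , e₂) = rows-injective 1 u v
  (trans (sym (toList∘fromList (firstRow 1 u))) (trans e₁ (toList∘fromList (firstRow 1 v))))
  (trans (sym (toList∘fromList (secondRow 1 u))) (trans e₂ (toList∘fromList (secondRow 1 v))))

tableauRows⇒IsBallot : ∀ {N} (t : TwoRowSYT N) w → length w ≡ N →
                       firstRow 1 w ≡ toList (r1 t) → secondRow 1 w ≡ toList (r2 t) → IsBallot true N 0 w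
tableauRows⇒IsBallot t w |w| w₁ w₂ = |w| , ballot , hasDown
  where
  ballot : Ballot 0 w
  ballot = columnStrict⇒ballot w 1 [] []
    (subst₂ ColumnStrict (sym w₁) (sym w₂) (toList-columnStrict (r1 t) (r2 t) (b≤a t) (col t)))
  nonempty : ∀ {n} (v : Vec ℕ n) → 1 ≤ n → Σ ℕ (_∈ toList v)
  nonempty (y ∷ _) _ = y , here refl
  hasDown : T true → false ∈ w
  hasDown _ with y , y∈ ← nonempty (r2 t) (b≥1 t) = ∈-secondRow⇒false∈ 1 w (subst (y ∈_) (sym w₂) y∈)

tableau-word : ∀ {N} (t : TwoRowSYT N) →
               Σ[ w ∈ Word ] IsBallot true N 0 w × firstRow 1 w ≡ toList (r1 t) × secondRow 1 w ≡ toList (r2 t)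
tableau-word {N} t
  with w , |w| , w₁ , w₂ ← rows-surjective 1 N (toList-sorted (r1 t) (row1 t)) (toList-sorted (r2 t) (row2 t))
                                             (subst (_ ↭_) (map-suc-upTo N) (fill t))
  = w , tableauRows⇒IsBallot t w |w| w₁ w₂ , w₁ , w₂

All-mapWith∈ : ∀ {A B : Set} {P : B → Set} {xs : List A} (f : ∀ {x} → x ∈ xs → B) →
               (∀ {x} (x∈ : x ∈ xs) → P (f x∈)) → All P (mapWith∈ xs f)
All-mapWith∈ {xs = []}     f pf = []
All-mapWith∈ {xs = x ∷ xs} f pf =
  pf (here refl) ∷ All-mapWith∈ (λ x∈ → f (there x∈)) (λ x∈ → pf (there x∈))

mapWith∈-distinct : ∀ {A B : Set} {_≈_ : B → B → Set} {xs : List A} (f : ∀ {x} → x ∈ xs → B) →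
                    (∀ {x y} (x∈ : x ∈ xs) (y∈ : y ∈ xs) → f x∈ ≈ f y∈ → x ≡ y) →
                    Unique xs → AllPairs (λ s t → ¬ s ≈ t) (mapWith∈ xs f)
mapWith∈-distinct {xs = []}     f inj []            = []
mapWith∈-distinct {xs = x ∷ xs} f inj (x∉xs ∷ xs!) =
  All-mapWith∈ (λ y∈ → f (there y∈)) (λ y∈ fx≈fy → All.lookup x∉xs y∈ (inj (here refl) (there y∈) fx≈fy))
  ∷ mapWith∈-distinct (λ y∈ → f (there y∈)) (λ x∈ y∈ → inj (there x∈) (there y∈)) xs!

ballotTableau : ∀ N {w} → w ∈ ballots true N 0 → TwoRowSYT N
ballotTableau N {w} w∈ = wordTableau w (All.lookup (ballots-sound true N 0) w∈)

tableaux : ∀ N → List (TwoRowSYT N)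
tableaux N = mapWith∈ (ballots true N 0) (ballotTableau N)

tableaux-enumerates : ∀ N → Enumerates N (tableaux N)
tableaux-enumerates N = complete , distinct
  where
  complete : ∀ t → Any (t ≈T_) (tableaux N)
  complete t with w , (|w| , ballot , hasDown) , w₁ , w₂ ← tableau-word t =
    mapWith∈⁺ (ballotTableau N) (w , w∈ , trans (sym w₁) (sym (toList∘fromList (firstRow 1 w)))
                                        , trans (sym w₂) (sym (toList∘fromList (secondRow 1 w))))
    where w∈ : w ∈ ballots true N 0
          w∈ = subst (λ n → w ∈ ballots true n 0) |w| (ballots-complete true w 0 ballot hasDown)
  distinct : AllPairs (λ s t → ¬ s ≈T t) (tableaux N)
  distinct = mapWith∈-distinct {_≈_ = _≈T_} (ballotTableau N)
               (λ {u} {v} u∈ v∈ → wordTableau-injective u v (sound u∈) (sound v∈))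
               (ballots-unique true N 0)
    where sound : ∀ {w} → w ∈ ballots true N 0 → IsBallot true N 0 w
          sound = All.lookup (ballots-sound true N 0)

suc-length-tableaux : ∀ N → suc (length (tableaux N)) ≡ ballotCount N 0
suc-length-tableaux N = begin
  suc (length (tableaux N))          ≡⟨ cong suc (SetoidMembership.length-mapWith∈ (setoid Word) (ballots true N 0)) ⟩
  suc (length (ballots true N 0))    ≡⟨ length-ballots-true N 0 ⟩
  length (ballots false N 0)         ≡⟨ length-ballots-false N 0 ⟩
  ballotCount N 0                    ∎

parity≡0ℙ⇒2∣ : ∀ n → parity n ≡ 0ℙ → 2 ∣ n
parity≡0ℙ⇒2∣ zero          _ = divides 0 refl
parity≡0ℙ⇒2∣ (suc (suc n)) p with divides q n≡q*2 ← parity≡0ℙ⇒2∣ n p =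
  divides (suc q) (cong (2 +_) n≡q*2)

corollary1 : ∀ (k : ℕ) → 1 ≤ k →
    Σ (List (TwoRowSYT (2 ^ k ∸ 1))) λ L →
      Enumerates (2 ^ k ∸ 1) L × (2 ∣ length L)
corollary1 (suc k) _ = tableaux N , tableaux-enumerates N , parity≡0ℙ⇒2∣ (length (tableaux N)) even
  where
  N : ℕ
  N = 2 ^ suc k ∸ 1
  even : parity (length (tableaux N)) ≡ 0ℙ
  even = begin
    parity (length (tableaux N))                 ≡⟨ suc-homo-⁻¹ (length (tableaux N)) ⟨
    parity (suc (length (tableaux N))) ⁻¹        ≡⟨ cong (λ n → parity n ⁻¹) (suc-length-tableaux N) ⟩
    parity (ballotCount N 0) ⁻¹                  ≡⟨ cong (λ n → parity (ballotCount n 0) ⁻¹) (2^k∸1≡mersenne (suc k)) ⟩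
    parity (ballotCount (mersenne (suc k)) 0) ⁻¹ ≡⟨ cong _⁻¹ (parity-ballotCount-mersenne k) ⟩
    0ℙ                                           ∎
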